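{- For each $i\in\{1,2,3,4\}$ there exists an infinite Dean word $w$ with $\mathit{D}_3(w)=S_i$, where \begin{align*} S_1&=\{101,123,212,232,303,321\},\quad S_2=\{012,030,101,121,210,232\},\\ S_3&=\{010,032,212,230,303,323\},\quad S_4=\{010,030,103,121,301,323\}. \end{align*}
   Context: Words are over the alphabet $\Sigma_4=\{0,1,2,3\}$. A word is reduced if it has no factor in $\{02,20,13,31\}$. A Dean word is a finite or infinite reduced word that is square-free, i.e. has no factor $uu$ with $u$ nonempty. For a Dean word $w$ and $l\ge 2$, $\mathit{D}_l(w)$ is the set of reduced words $v$ of length $l$ that are not factors of $w$ but whose prefix and suffix of length $l-1$ are factors of $w$. -}

module Defs where

open import Data.Nat using (ℕ; zero; suc; _+_; _∸_; _<_; _≥_)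
open import Data.Fin using (Fin; zero; suc)
open import Data.List using (List; []; _∷_; length; lookup; take; drop; map)
open import Data.List.Membership.Propositional using (_∈_)
open import Data.Product using (Σ; ∃; _×_; _,_)
open import Data.Empty using (⊥)
open import Data.Unit using (⊤)
open import Data.Sum using (_⊎_)
open import Relation.Nullary using (¬_)
open import Relation.Binary.PropositionalEquality using (_≡_)
open import Function.Bundles using (_⇔_)

Letter : Set
Letter = Fin 4

InfWord : Set
InfWord = ℕ → Letter

Word : Set
Word = List Letter

l0 l1 l2 l3 : Letter
l0 = zero
l1 = suc zero
l2 = suc (suc zero)
l3 = suc (suc (suc zero))

Forbidden : Letter → Letter → Set
Forbidden a b = (a ≡ l0 × b ≡ l2) ⊎ (a ≡ l2 × b ≡ l0)
           ⊎ (a ≡ l1 × b ≡ l3) ⊎ (a ≡ l3 × b ≡ l1)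

ReducedW : Word → Set
ReducedW [] = ⊤
ReducedW (a ∷ []) = ⊤
ReducedW (a ∷ b ∷ u) = ¬ Forbidden a b × ReducedW (b ∷ u)

Reduced : InfWord → Set
Reduced w = ∀ i → ¬ Forbidden (w i) (w (suc i))

-- Square-free infinite word: no factor uu with u nonempty,
-- i.e. no position i and length n ≥ 1 with w(i+j) = w(i+n+j) for all j < n.
SquareFree : InfWord → Set
SquareFree w = ∀ i n → n ≥ 1 → ¬ (∀ j → j < n → w (i + j) ≡ w (i + n + j))

Dean : InfWord → Set
Dean w = Reduced w × SquareFree w

OccursAt : Word → InfWord → ℕ → Set
OccursAt [] w i = ⊤
OccursAt (a ∷ u) w i = w i ≡ a × OccursAt u w (suc i)

Factor : Word → InfWord → Set
Factor u w = ∃ λ i → OccursAt u w i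

InD : ℕ → InfWord → Word → Set
InD l w v = length v ≡ l × ReducedW v × ¬ Factor v w
          × Factor (take (l ∸ 1) v) w × Factor (drop 1 v) w

w3 : Letter → Letter → Letter → Word
w3 a b c = a ∷ b ∷ c ∷ []

S₁ S₂ S₃ S₄ : List Word
S₁ = w3 l1 l0 l1 ∷ w3 l1 l2 l3 ∷ w3 l2 l1 l2 ∷ w3 l2 l3 l2 ∷ w3 l3 l0 l3 ∷ w3 l3 l2 l1 ∷ []
S₂ = w3 l0 l1 l2 ∷ w3 l0 l3 l0 ∷ w3 l1 l0 l1 ∷ w3 l1 l2 l1 ∷ w3 l2 l1 l0 ∷ w3 l2 l3 l2 ∷ []
S₃ = w3 l0 l1 l0 ∷ w3 l0 l3 l2 ∷ w3 l2 l1 l2 ∷ w3 l2 l3 l0 ∷ w3 l3 l0 l3 ∷ w3 l3 l2 l3 ∷ []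
S₄ = w3 l0 l1 l0 ∷ w3 l0 l3 l0 ∷ w3 l1 l0 l3 ∷ w3 l1 l2 l1 ∷ w3 l3 l0 l1 ∷ w3 l3 l2 l3 ∷ []

S : Fin 4 → List Word
S zero = S₁
S (suc zero) = S₂
S (suc (suc zero)) = S₃
S (suc (suc (suc zero))) = S₄

DEquals : ℕ → InfWord → List Word → Set
DEquals l w T = ∀ v → InD l w v ⇔ v ∈ T

-- The four words are the rotations a ↦ a + k (mod 4) of one word w₀ = τ ∘ x, where x is the
-- fixed point of a 4-uniform morphism h on twelve letters and τ is a letter-to-letter coding.
-- Rotations preserve reducedness and square-freeness, so only w₀ must be shown to be Dean.
-- Every factor of length 4 of x occurs before position 28, and desubstitution propagates this
-- to longer factors; hence any property of short factors is a finite computation, and so is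
-- D₃ of each rotation. Squares of period below 12
-- are excluded by inspecting the factors of length 22. A factor of length 12 of w₀ determines
-- its position modulo 4 together with the parity of the preimage position, so a square of
-- period n ≥ 12 has n = 4m with m even; as τ of a letter of x is determined by its parity (that
-- of its position) and part of its coded image, the square pulls back to a square of period m.
module Submission where

open import Agda.Builtin.FromNat using (Number; fromNat)
open import Data.Fin as Fin using (Fin; toℕ; fromℕ<; combine)
open import Data.Fin.Literals as Fin using ()
open import Data.Fin.Patterns using (0F; 1F; 2F; 3F)
open import Data.Fin.Properties using (all?; any?; toℕ-fromℕ<; toℕ-injective; toℕ<n; toℕ≤pred[n]; toℕ-combine)
open import Data.List using (List; []; _∷_; _++_; length; take; drop; map; concatMap)
open import Data.List.Membership.Propositional using (_∈_)
open import Data.List.Properties using (∷-injective; ≡-dec; ++-identityʳ; take-map; drop-map)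
open import Data.List.Relation.Unary.All as All using (All)
open import Data.Nat using (ℕ; zero; suc; _+_; _*_; _∸_; _/_; _%_; _≤_; _<_; _≥_; _<?_; _≤?_; z≤n; s≤s; s≤s⁻¹; z<s; s<s; NonZero; >-nonZero; >-nonZero⁻¹)
open import Data.Nat.DivMod using (_mod_; _divMod_; DivMod; m≡m%n+[m/n]*n; m/n<m; m<n⇒m/n≡0; m*n/n≡m; +-distrib-/-∣ʳ; [m+kn]%n≡m%n; m<n⇒m%n≡m; m%n<n; %-remove-+ʳ; m∣n⇒o%n%m≡o%m)
open import Data.Nat.Divisibility using (_∣_; divides; divides-refl)
open import Data.Nat.Induction using (<-rec)
open import Data.Nat.Literals as ℕ using ()
open import Data.Nat.Properties
open import Data.Nat.Tactic.RingSolver using (solve-∀)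
open import Data.Product using (∃; ∃₂; _×_; _,_; proj₁; proj₂)
open import Data.Unit using (tt)
open import Data.Vec using (Vec; []; _∷_; lookup; toList)
open import Function using (_∘_; _⇔_; mk⇔; Equivalence)
open import Relation.Binary.PropositionalEquality
open import Relation.Nullary using (¬_)
open import Relation.Nullary.Decidable as Dec using (Dec; yes; no; True; toWitness; from-yes; _×-dec_; _⊎-dec_; _→-dec_; ¬?)
open import Defs
open import Data.List.Membership.DecPropositional {A = Word} (≡-dec Fin._≟_) using (_∈?_)

open ≡-Reasoning

instance
  ℕ-literals : Number ℕ
  ℕ-literals = ℕ.number

  Fin-literals : ∀ {n} → Number (Fin n)
  Fin-literals {n} = Fin.number n

private
  variable
    A B : Set

-- Factors of infinite words

factor : (ℕ → A) → ℕ → ℕ → List A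
factor w i zero    = []
factor w i (suc n) = w i ∷ factor w (suc i) n

factor-++ : ∀ (w : ℕ → A) i m n → factor w i (m + n) ≡ factor w i m ++ factor w (i + m) n
factor-++ w i zero    n = cong (λ j → factor w j n) (sym (+-identityʳ i))
factor-++ w i (suc m) n = cong (w i ∷_) (begin
  factor w (suc i) (m + n)                        ≡⟨ factor-++ w (suc i) m n ⟩
  factor w (suc i) m ++ factor w (suc i + m) n    ≡⟨ cong (λ j → factor w (suc i) m ++ factor w j n) (+-suc i m) ⟨
  factor w (suc i) m ++ factor w (i + suc m) n    ∎)

take-factor : ∀ (w : ℕ → A) i {ℓ n} → ℓ ≤ n → take ℓ (factor w i n) ≡ factor w i ℓ
take-factor w i {zero}  _         = refl
take-factor w i {suc ℓ} (s≤s ℓ≤n) = cong (w i ∷_) (take-factor w (suc i) ℓ≤n)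

take-drop-factor : ∀ (w : ℕ → A) i d {ℓ n} → d + ℓ ≤ n →
                   take ℓ (drop d (factor w i n)) ≡ factor w (i + d) ℓ
take-drop-factor w i zero    {ℓ} d+ℓ≤n       =
  trans (take-factor w i d+ℓ≤n) (cong (λ j → factor w j ℓ) (sym (+-identityʳ i)))
take-drop-factor w i (suc d) {ℓ} (s≤s d+ℓ≤n) =
  trans (take-drop-factor w (suc i) d d+ℓ≤n) (cong (λ j → factor w j ℓ) (sym (+-suc i d)))

map-factor : ∀ (f : A → B) (w : ℕ → A) i n → map f (factor w i n) ≡ factor (f ∘ w) i n
map-factor f w i zero    = refl
map-factor f w i (suc n) = cong (f (w i) ∷_) (map-factor f w (suc i) n)

factor≡toList : ∀ {n} (w : ℕ → A) i (v : Vec A n) → (∀ r → w (i + toℕ r) ≡ lookup v r) →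
                factor w i n ≡ toList v
factor≡toList w i []      eq = refl
factor≡toList w i (c ∷ v) eq =
  cong₂ _∷_ (trans (cong w (sym (+-identityʳ i))) (eq 0F))
            (factor≡toList w (suc i) v λ r → trans (cong w (sym (+-suc i (toℕ r)))) (eq (Fin.suc r)))

factor-cong : ∀ (u v : ℕ → A) i j n → (∀ k → k < n → u (i + k) ≡ v (j + k)) →
              factor u i n ≡ factor v j n
factor-cong u v i j zero    _  = refl
factor-cong u v i j (suc n) eq =
  cong₂ _∷_ (subst₂ (λ i′ j′ → u i′ ≡ v j′) (+-identityʳ i) (+-identityʳ j) (eq 0 z<s))
            (factor-cong u v (suc i) (suc j) n λ k k<n →
               subst₂ (λ i′ j′ → u i′ ≡ v j′) (+-suc i k) (+-suc j k) (eq (suc k) (s<s k<n)))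

factor-≡⇒≡ : ∀ (u v : ℕ → A) i j n → factor u i n ≡ factor v j n →
             ∀ k → k < n → u (i + k) ≡ v (j + k)
factor-≡⇒≡ u v i j (suc n) eq zero    _         =
  subst₂ (λ i′ j′ → u i′ ≡ v j′) (sym (+-identityʳ i)) (sym (+-identityʳ j)) (proj₁ (∷-injective eq))
factor-≡⇒≡ u v i j (suc n) eq (suc k) (s≤s k<n) =
  subst₂ (λ i′ j′ → u i′ ≡ v j′) (sym (+-suc i k)) (sym (+-suc j k))
         (factor-≡⇒≡ u v (suc i) (suc j) n (proj₂ (∷-injective eq)) k k<n)

factor-∘-cong : ∀ (f : A → B) (w : ℕ → A) i j n → factor w i n ≡ factor w j n →
                factor (f ∘ w) i n ≡ factor (f ∘ w) j n
factor-∘-cong f w i j n eq = begin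
  factor (f ∘ w) i n     ≡⟨ map-factor f w i n ⟨
  map f (factor w i n)   ≡⟨ cong (map f) eq ⟩
  map f (factor w j n)   ≡⟨ map-factor f w j n ⟩
  factor (f ∘ w) j n     ∎

factor-≡-take : ∀ (w : ℕ → A) i j {ℓ n} → ℓ ≤ n → factor w i n ≡ factor w j n →
                factor w i ℓ ≡ factor w j ℓ
factor-≡-take w i j {ℓ} {n} ℓ≤n eq = begin
  factor w i ℓ            ≡⟨ take-factor w i ℓ≤n ⟨
  take ℓ (factor w i n)   ≡⟨ cong (take ℓ) eq ⟩
  take ℓ (factor w j n)   ≡⟨ take-factor w j ℓ≤n ⟩
  factor w j ℓ            ∎

occursAt⇔factor : ∀ (v : Word) w i → OccursAt v w i ⇔ factor w i (length v) ≡ v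
occursAt⇔factor v w i = mk⇔ (to v i) (from v i)
  where
  to : ∀ v i → OccursAt v w i → factor w i (length v) ≡ v
  to []      i _              = refl
  to (a ∷ v) i (wi≡a , occurs) = cong₂ _∷_ wi≡a (to v (suc i) occurs)
  from : ∀ v i → factor w i (length v) ≡ v → OccursAt v w i
  from []      i _  = tt
  from (a ∷ v) i eq = proj₁ (∷-injective eq) , from v (suc i) (proj₂ (∷-injective eq))

Square : (ℕ → A) → ℕ → ℕ → Set
Square w i n = ∀ j → j < n → w (i + j) ≡ w (i + n + j)

factor≡⇔square : ∀ (w : ℕ → A) i n → factor w i n ≡ factor w (i + n) n ⇔ Square w i n
factor≡⇔square w i n = mk⇔ (factor-≡⇒≡ w w i (i + n) n) (factor-cong w w i (i + n) n)

square⇒prefix≡ : ∀ (w : ℕ → A) i n {ℓ} → ℓ ≤ n → Square w i n → factor w i ℓ ≡ factor w (i + n) ℓ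
square⇒prefix≡ w i n ℓ≤n sq =
  factor-≡-take w i (i + n) ℓ≤n (Equivalence.from (factor≡⇔square w i n) sq)

square⇒factor≡ : ∀ (w : ℕ → A) i n {e ℓ} → e + ℓ ≤ n → Square w i n →
                 factor w (i + e) ℓ ≡ factor w (i + n + e) ℓ
square⇒factor≡ w i n {e} {ℓ} e+ℓ≤n sq = factor-cong w w (i + e) (i + n + e) ℓ λ k k<ℓ →
  subst₂ (λ p p′ → w p ≡ w p′) (sym (+-assoc i e k)) (sym (+-assoc (i + n) e k))
         (sq (e + k) (<-≤-trans (+-monoʳ-< e k<ℓ) e+ℓ≤n))

square-transfer : ∀ (w : ℕ → A) i j n {ℓ} → n + n ≤ ℓ → factor w i ℓ ≡ factor w j ℓ →
                  Square w i n → Square w j n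
square-transfer w i j n {ℓ} 2n≤ℓ eq sq k k<n = begin
  w (j + k)          ≡⟨ same k (<-≤-trans k<n (≤-trans (m≤m+n n n) 2n≤ℓ)) ⟨
  w (i + k)          ≡⟨ sq k k<n ⟩
  w (i + n + k)      ≡⟨ cong w (+-assoc i n k) ⟩
  w (i + (n + k))    ≡⟨ same (n + k) (<-≤-trans (+-monoʳ-< n k<n) 2n≤ℓ) ⟩
  w (j + (n + k))    ≡⟨ cong w (+-assoc j n k) ⟨
  w (j + n + k)      ∎
  where
  same : ∀ k → k < ℓ → w (i + k) ≡ w (j + k)
  same = factor-≡⇒≡ w w i j ℓ eq

square? : ∀ (w : InfWord) i n → Dec (Square w i n)
square? w i n = Dec.map (factor≡⇔square w i n) (≡-dec Fin._≟_ (factor w i n) (factor w (i + n) n))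

squareFree-by-descent : ∀ (w : InfWord) P →
  (∀ i n → 1 ≤ n → n < P → ¬ Square w i n) →
  (∀ i n → P ≤ n → Square w i n → ∃₂ λ j m → 1 ≤ m × m < n × Square w j m) →
  SquareFree w
squareFree-by-descent w P short descend i n = <-rec (λ n → ∀ i → n ≥ 1 → ¬ Square w i n) step n i
  where
  step : ∀ n → (∀ {m} → m < n → ∀ i → m ≥ 1 → ¬ Square w i m) → ∀ i → n ≥ 1 → ¬ Square w i n
  step n smaller i n≥1 sq with n <? P
  ... | yes n<P = short i n n≥1 n<P sq
  ... | no  n≮P with descend i n (≮⇒≥ n≮P) sq
  ...   | j , m , m≥1 , m<n , sq′ = smaller m<n j m≥1 sq′

forbidden? : ∀ a b → Dec (Forbidden a b)
forbidden? a b = (a Fin.≟ l0 ×-dec b Fin.≟ l2) ⊎-dec (a Fin.≟ l2 ×-dec b Fin.≟ l0)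
               ⊎-dec (a Fin.≟ l1 ×-dec b Fin.≟ l3) ⊎-dec (a Fin.≟ l3 ×-dec b Fin.≟ l1)

reducedW? : ∀ v → Dec (ReducedW v)
reducedW? []          = yes tt
reducedW? (a ∷ [])    = yes tt
reducedW? (a ∷ b ∷ v) = ¬? (forbidden? a b) ×-dec reducedW? (b ∷ v)

Dean-map : ∀ {w} (f : Letter → Letter) → (∀ {a b} → f a ≡ f b → a ≡ b) →
           (∀ {a b} → Forbidden (f a) (f b) → Forbidden a b) → Dean w → Dean (f ∘ w)
Dean-map f f-injective f-reflects (reduced , squareFree) =
  (λ i → reduced i ∘ f-reflects) ,
  (λ i n n≥1 sq → squareFree i n n≥1 (λ j j<n → f-injective (sq j j<n)))

_⇔?_ : ∀ {P Q : Set} → Dec P → Dec Q → Dec (P ⇔ Q)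
p? ⇔? q? = Dec.map′ (λ (to , from) → mk⇔ to from) (λ e → Equivalence.to e , Equivalence.from e)
                    ((p? →-dec q?) ×-dec (q? →-dec p?))

DEquals-by-length : ∀ {l w T} → All (λ v → length v ≡ l) T →
                    (∀ v → length v ≡ l → InD l w v ⇔ v ∈ T) → DEquals l w T
DEquals-by-length lengths words v =
  mk⇔ (λ inD → Equivalence.to (words v (proj₁ inD)) inD)
      (λ v∈T → Equivalence.from (words v (All.lookup lengths v∈T)) v∈T)

DEquals₃ : ∀ {w T} → All (λ v → length v ≡ 3) T →
           (∀ a b c → InD 3 w (a ∷ b ∷ c ∷ []) ⇔ (a ∷ b ∷ c ∷ []) ∈ T) → DEquals 3 w T
DEquals₃ {w} {T} lengths triples = DEquals-by-length lengths words
  where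
  words : ∀ v → length v ≡ 3 → InD 3 w v ⇔ v ∈ T
  words (a ∷ b ∷ c ∷ []) refl = triples a b c

m<n⇒m+ℓ≤ℓ*n : ∀ {m n} ℓ .{{_ : NonZero ℓ}} → m < n → m + ℓ ≤ ℓ * n
m<n⇒m+ℓ≤ℓ*n {m} {n@(suc _)} (suc ℓ) m<n = ≤-trans (≤-reflexive (+-suc m ℓ)) (+-mono-≤ m<n (m≤m*n ℓ n))

[r+q*n]/n≡q : ∀ {n} .{{_ : NonZero n}} (r : Fin n) q → (toℕ r + q * n) / n ≡ q
[r+q*n]/n≡q {n} r q = begin
  (toℕ r + q * n) / n      ≡⟨ +-distrib-/-∣ʳ (toℕ r) (divides-refl q) ⟩
  toℕ r / n + q * n / n    ≡⟨ cong₂ _+_ (m<n⇒m/n≡0 (toℕ<n r)) (m*n/n≡m q n) ⟩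
  q                        ∎

[r+q*n]mod-n≡r : ∀ {n} .{{_ : NonZero n}} (r : Fin n) q → (toℕ r + q * n) mod n ≡ r
[r+q*n]mod-n≡r {n} r q = toℕ-injective (begin
  toℕ ((toℕ r + q * n) mod n)   ≡⟨ toℕ-fromℕ< _ ⟩
  (toℕ r + q * n) % n           ≡⟨ [m+kn]%n≡m%n (toℕ r) q n ⟩
  toℕ r % n                     ≡⟨ m<n⇒m%n≡m (toℕ<n r) ⟩
  toℕ r                         ∎)

≡-mod⇒∣-difference : ∀ d .{{_ : NonZero d}} q m → (q + m) % d ≡ q % d → d ∣ m
≡-mod⇒∣-difference d q m eq = divides ((q + m) / d ∸ q / d) (begin
  m                                                   ≡⟨ m+n∸m≡n q m ⟨
  q + m ∸ q                                           ≡⟨ cong₂ _∸_ (m≡m%n+[m/n]*n (q + m) d) (m≡m%n+[m/n]*n q d) ⟩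
  (q + m) % d + (q + m) / d * d ∸ (q % d + q / d * d)
    ≡⟨ cong (λ r → (q + m) % d + (q + m) / d * d ∸ (r + q / d * d)) eq ⟨
  (q + m) % d + (q + m) / d * d ∸ ((q + m) % d + q / d * d)
    ≡⟨ [m+n]∸[m+o]≡n∸o ((q + m) % d) _ _ ⟩
  (q + m) / d * d ∸ q / d * d                         ≡⟨ *-distribʳ-∸ d ((q + m) / d) (q / d) ⟨
  ((q + m) / d ∸ q / d) * d                           ∎)

aligned-period : ∀ b .{{_ : NonZero b}} {r q q′ n} → r + q * b + n ≡ r + q′ * b →
                 q ≤ q′ × n ≡ (q′ ∸ q) * b
aligned-period b {r} {q} {q′} {n} eq = q≤q′ , (begin
  n                    ≡⟨ m+n∸m≡n (q * b) n ⟨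
  q * b + n ∸ q * b    ≡⟨ cong (_∸ q * b) shifted ⟩
  q′ * b ∸ q * b       ≡⟨ *-distribʳ-∸ b q′ q ⟨
  (q′ ∸ q) * b         ∎)
  where
  shifted : q * b + n ≡ q′ * b
  shifted = +-cancelˡ-≡ r _ _ (trans (sym (+-assoc r (q * b) n)) eq)
  q≤q′ : q ≤ q′
  q≤q′ = *-cancelʳ-≤ q q′ b (≤-trans (m≤m+n (q * b) n) (≤-reflexive shifted))

-- Fixed points of uniform morphisms

module UniformMorphism {A : Set} {k : ℕ} (h : A → Vec A (2 + k)) (a : A) (prolongable : lookup (h a) 0F ≡ a) where

  b : ℕ
  b = 2 + k

  private
    quotient< : ∀ n .{{_ : NonZero n}} → n / b < n
    quotient< n = m/n<m n b (s≤s (s≤s z≤n))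

    -- Fuel n suffices for position n; the clause for position 0 keeps evaluation logarithmic.
    fixWithFuel : ℕ → ℕ → A
    fixWithFuel zero    _         = a
    fixWithFuel (suc f) zero      = a
    fixWithFuel (suc f) n@(suc _) = lookup (h (fixWithFuel f (n / b))) (n mod b)

    fuel-irrelevant : ∀ {f g} n → n ≤ f → n ≤ g → fixWithFuel f n ≡ fixWithFuel g n
    fuel-irrelevant {zero}  {zero}  zero _ _ = refl
    fuel-irrelevant {zero}  {suc g} zero _ _ = refl
    fuel-irrelevant {suc f} {zero}  zero _ _ = refl
    fuel-irrelevant {suc f} {suc g} zero _ _ = refl
    fuel-irrelevant {suc f} {suc g} n@(suc _) (s≤s n≤f) (s≤s n≤g) =
      cong (λ z → lookup (h z) (n mod b))
           (fuel-irrelevant (n / b) (≤-trans (s≤s⁻¹ (quotient< n)) n≤f)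
                                    (≤-trans (s≤s⁻¹ (quotient< n)) n≤g))

  fix : ℕ → A
  fix n = fixWithFuel n n

  fix-unfold : ∀ n → fix n ≡ lookup (h (fix (n / b))) (n mod b)
  fix-unfold zero      = sym prolongable
  fix-unfold n@(suc _) =
    cong (λ z → lookup (h z) (n mod b)) (fuel-irrelevant (n / b) (s≤s⁻¹ (quotient< n)) ≤-refl)

  fix-block : ∀ q (r : Fin b) → fix (toℕ r + q * b) ≡ lookup (h (fix q)) r
  fix-block q r = trans (fix-unfold (toℕ r + q * b))
                        (cong₂ (λ q′ r′ → lookup (h (fix q′)) r′) ([r+q*n]/n≡q r q) ([r+q*n]mod-n≡r r q))

  image : List A → List A
  image = concatMap (toList ∘ h)

  factor-fix-image : ∀ q L → factor fix (q * b) (L * b) ≡ image (factor fix q L)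
  factor-fix-image q zero    = refl
  factor-fix-image q (suc L) = begin
    factor fix (q * b) (b + L * b)                             ≡⟨ factor-++ fix (q * b) b (L * b) ⟩
    factor fix (q * b) b ++ factor fix (q * b + b) (L * b)     ≡⟨ cong₂ _++_ block rest ⟩
    toList (h (fix q)) ++ image (factor fix (suc q) L)         ∎
    where
    block : factor fix (q * b) b ≡ toList (h (fix q))
    block = factor≡toList fix (q * b) (h (fix q)) λ r → trans (cong fix (+-comm (q * b) (toℕ r))) (fix-block q r)
    rest : factor fix (q * b + b) (L * b) ≡ image (factor fix (suc q) L)
    rest = trans (cong (λ i → factor fix i (L * b)) (+-comm (q * b) b)) (factor-fix-image (suc q) L)

  factor-fix-in-image : ∀ q L (r : Fin b) {ℓ} → toℕ r + ℓ ≤ L * b →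
                        factor fix (toℕ r + q * b) ℓ ≡ take ℓ (drop (toℕ r) (image (factor fix q L)))
  factor-fix-in-image q L r {ℓ} r+ℓ≤Lb = begin
    factor fix (toℕ r + q * b) ℓ                         ≡⟨ cong (λ i → factor fix i ℓ) (+-comm (toℕ r) (q * b)) ⟩
    factor fix (q * b + toℕ r) ℓ                         ≡⟨ take-drop-factor fix (q * b) (toℕ r) r+ℓ≤Lb ⟨
    take ℓ (drop (toℕ r) (factor fix (q * b) (L * b)))   ≡⟨ cong (take ℓ ∘ drop (toℕ r)) (factor-fix-image q L) ⟩
    take ℓ (drop (toℕ r) (image (factor fix q L)))       ∎

  factor-fix-desubst : ∀ {q j L ℓ} (r : Fin b) → toℕ r + ℓ ≤ L * b → factor fix q L ≡ factor fix j L →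
                       factor fix (toℕ r + q * b) ℓ ≡ factor fix (toℕ r + j * b) ℓ
  factor-fix-desubst {q} {j} {L} {ℓ} r r+ℓ≤Lb eq = begin
    factor fix (toℕ r + q * b) ℓ                     ≡⟨ factor-fix-in-image q L r r+ℓ≤Lb ⟩
    take ℓ (drop (toℕ r) (image (factor fix q L)))   ≡⟨ cong (take ℓ ∘ drop (toℕ r) ∘ image) eq ⟩
    take ℓ (drop (toℕ r) (image (factor fix j L)))   ≡⟨ factor-fix-in-image j L r r+ℓ≤Lb ⟨
    factor fix (toℕ r + j * b) ℓ                     ∎

  Represented : ℕ → ℕ → Set
  Represented L N = ∀ i → ∃ λ (j : Fin N) → factor fix i L ≡ factor fix (toℕ j) L

  private
    represented-step : ∀ {L N ℓ} i (j : Fin N) → toℕ (i mod b) + ℓ ≤ L * b →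
                       factor fix (i / b) L ≡ factor fix (toℕ j) L →
                       factor fix i ℓ ≡ factor fix (toℕ (combine j (i mod b))) ℓ
    represented-step {ℓ = ℓ} i j r+ℓ≤Lb eq = begin
      factor fix i ℓ                              ≡⟨ cong (λ i → factor fix i ℓ) (DivMod.property (i divMod b)) ⟩
      factor fix (toℕ (i mod b) + i / b * b) ℓ    ≡⟨ factor-fix-desubst (i mod b) r+ℓ≤Lb eq ⟩
      factor fix (toℕ (i mod b) + toℕ j * b) ℓ    ≡⟨ cong (λ i → factor fix i ℓ) position ⟩
      factor fix (toℕ (combine j (i mod b))) ℓ    ∎
      where
      position : toℕ (i mod b) + toℕ j * b ≡ toℕ (combine j (i mod b))
      position = begin
        toℕ (i mod b) + toℕ j * b   ≡⟨ +-comm (toℕ (i mod b)) (toℕ j * b) ⟩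
        toℕ j * b + toℕ (i mod b)   ≡⟨ cong (_+ toℕ (i mod b)) (*-comm (toℕ j) b) ⟩
        b * toℕ j + toℕ (i mod b)   ≡⟨ toℕ-combine j (i mod b) ⟨
        toℕ (combine j (i mod b))   ∎

  represented : ∀ {L N} .{{_ : NonZero L}} .{{_ : NonZero N}} →
                (∀ (i : Fin (N * b)) → ∃ λ (j : Fin N) → factor fix (toℕ i) L ≡ factor fix (toℕ j) L) →
                Represented L N
  represented {L} {N} early = <-rec _ step
    where
    step : ∀ i → (∀ {i′} → i′ < i → ∃ λ (j : Fin N) → factor fix i′ L ≡ factor fix (toℕ j) L) →
           ∃ λ (j : Fin N) → factor fix i L ≡ factor fix (toℕ j) L
    step zero      _       = fromℕ< (>-nonZero⁻¹ N) , cong (λ i → factor fix i L) (sym (toℕ-fromℕ< _))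
    step i@(suc _) smaller with smaller (quotient< i)
    ... | j , eq with early (combine j (i mod b))
    ...   | j′ , eq′ = j′ , trans (represented-step i j (m<n⇒m+ℓ≤ℓ*n L (toℕ<n (i mod b))) eq) eq′

  represented-longer : ∀ {L N ℓ} → suc k + ℓ ≤ L * b → Represented L N → Represented ℓ (N * b)
  represented-longer {ℓ = ℓ} bound rep i with rep (i / b)
  ... | j , eq = combine j (i mod b) ,
                 represented-step i j (≤-trans (+-monoˡ-≤ ℓ (toℕ≤pred[n] (i mod b))) bound) eq

-- The word w₀

Γ : Set
Γ = Fin 12

h : Γ → Vec Γ 4
h = lookup
  ( (0 ∷ 1 ∷ 6 ∷ 7 ∷ [])
  ∷ (2 ∷ 3 ∷ 4 ∷ 5 ∷ [])
  ∷ (0 ∷ 1 ∷ 6 ∷ 7 ∷ [])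
  ∷ (2 ∷ 3 ∷ 4 ∷ 5 ∷ [])
  ∷ (8 ∷ 9 ∷ 10 ∷ 11 ∷ [])
  ∷ (2 ∷ 3 ∷ 4 ∷ 5 ∷ [])
  ∷ (6 ∷ 7 ∷ 0 ∷ 1 ∷ [])
  ∷ (8 ∷ 9 ∷ 10 ∷ 11 ∷ [])
  ∷ (6 ∷ 7 ∷ 0 ∷ 1 ∷ [])
  ∷ (8 ∷ 9 ∷ 10 ∷ 11 ∷ [])
  ∷ (2 ∷ 3 ∷ 4 ∷ 5 ∷ [])
  ∷ (8 ∷ 9 ∷ 10 ∷ 11 ∷ [])
  ∷ [])

τ : Γ → Letter
τ = lookup (0 ∷ 1 ∷ 0 ∷ 1 ∷ 2 ∷ 1 ∷ 0 ∷ 3 ∷ 0 ∷ 3 ∷ 2 ∷ 3 ∷ [])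

open UniformMorphism h 0 refl renaming (fix to x)

w₀ : InfWord
w₀ = τ ∘ x

x-parity : ∀ n → toℕ (x n) % 2 ≡ n % 2
x-parity n = begin
  toℕ (x n) % 2                                ≡⟨ cong (λ g → toℕ g % 2) (fix-unfold n) ⟩
  toℕ (lookup (h (x (n / 4))) (n mod 4)) % 2   ≡⟨ h-parity (x (n / 4)) (n mod 4) ⟩
  toℕ (n mod 4) % 2                            ≡⟨ cong (_% 2) (toℕ-fromℕ< (m%n<n n 4)) ⟩
  n % 4 % 2                                    ≡⟨ m∣n⇒o%n%m≡o%m 2 4 n (divides 2 refl) ⟩
  n % 2                                        ∎
  where
  h-parity : ∀ g r → toℕ (lookup (h g) r) % 2 ≡ toℕ r % 2
  h-parity = from-yes (all? λ (g : Γ) → all? λ (r : Fin 4) → toℕ (lookup (h g) r) % 2 ≟ toℕ r % 2)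

represented₄ : Represented 4 28
represented₄ = represented (from-yes (all? λ (i : Fin 112) → any? λ (j : Fin 28) →
  ≡-dec Fin._≟_ (factor x (toℕ i) 4) (factor x (toℕ j) 4)))

represented₂₂ : Represented 22 448
represented₂₂ = represented-longer (from-yes (3 + 22 ≤? 7 * 4))
                  (represented-longer (from-yes (3 + 7 ≤? 4 * 4)) represented₄)

w₀-reduced : Reduced w₀
w₀-reduced i = proj₁ (subst ReducedW (sym moved) (checked j))
  where
  j : Fin 28
  j = proj₁ (represented₄ i)
  moved : factor w₀ i 4 ≡ factor w₀ (toℕ j) 4
  moved = factor-∘-cong τ x i (toℕ j) 4 (proj₂ (represented₄ i))
  checked : ∀ (j : Fin 28) → ReducedW (factor w₀ (toℕ j) 4)
  checked = from-yes (all? λ (j : Fin 28) → reducedW? (factor w₀ (toℕ j) 4))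

no-short-squares : ∀ i n → 1 ≤ n → n < 12 → ¬ Square w₀ i n
no-short-squares i n n≥1 n<12 sq =
  checked j n<12 n≥1 (square-transfer w₀ i (toℕ j) n (+-mono-≤ (s≤s⁻¹ n<12) (s≤s⁻¹ n<12)) moved sq)
  where
  j : Fin 448
  j = proj₁ (represented₂₂ i)
  moved : factor w₀ i 22 ≡ factor w₀ (toℕ j) 22
  moved = factor-∘-cong τ x i (toℕ j) 22 (proj₂ (represented₂₂ i))
  checked : ∀ (j : Fin 448) {n} → n < 12 → 1 ≤ n → ¬ Square w₀ (toℕ j) n
  checked = from-yes (all? λ (j : Fin 448) → allUpTo? (λ n → 1 ≤? n →-dec ¬? (square? w₀ (toℕ j) n)) 12)

synchronizing : ∀ q q′ (r r′ : Fin 4) → factor w₀ (toℕ r + q * 4) 12 ≡ factor w₀ (toℕ r′ + q′ * 4) 12 →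
                r ≡ r′ × q % 2 ≡ q′ % 2
synchronizing q q′ r r′ eq = proj₁ early , trans (parity-moves q) (trans (proj₂ early) (sym (parity-moves q′)))
  where
  rep : ℕ → Fin 28
  rep q = proj₁ (represented₄ q)
  key-moves : ∀ q (r : Fin 4) → factor w₀ (toℕ r + q * 4) 12 ≡ factor w₀ (toℕ r + toℕ (rep q) * 4) 12
  key-moves q r = factor-∘-cong τ x (toℕ r + q * 4) (toℕ r + toℕ (rep q) * 4) 12
    (factor-fix-desubst {q} {toℕ (rep q)} {4} {12} r (≤-trans (+-monoˡ-≤ 12 (toℕ≤pred[n] r)) (n≤1+n 15))
                        (proj₂ (represented₄ q)))
  parity-moves : ∀ q → q % 2 ≡ toℕ (rep q) % 2
  parity-moves q = begin
    q % 2                        ≡⟨ x-parity q ⟨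
    toℕ (x q) % 2                ≡⟨ cong (λ g → toℕ g % 2) (proj₁ (∷-injective (proj₂ (represented₄ q)))) ⟩
    toℕ (x (toℕ (rep q))) % 2    ≡⟨ x-parity (toℕ (rep q)) ⟩
    toℕ (rep q) % 2              ∎
  checked : ∀ (j j′ : Fin 28) (r r′ : Fin 4) →
            factor w₀ (toℕ r + toℕ j * 4) 12 ≡ factor w₀ (toℕ r′ + toℕ j′ * 4) 12 →
            r ≡ r′ × toℕ j % 2 ≡ toℕ j′ % 2
  checked = from-yes (all? λ (j : Fin 28) → all? λ (j′ : Fin 28) → all? λ (r : Fin 4) → all? λ (r′ : Fin 4) →
    ≡-dec Fin._≟_ (factor w₀ (toℕ r + toℕ j * 4) 12) (factor w₀ (toℕ r′ + toℕ j′ * 4) 12)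
      →-dec (r Fin.≟ r′ ×-dec toℕ j % 2 ≟ toℕ j′ % 2))
  early : r ≡ r′ × toℕ (rep q) % 2 ≡ toℕ (rep q′) % 2
  early = checked (rep q) (rep q′) r r′ (trans (sym (key-moves q r)) (trans eq (key-moves q′ r′)))

code : Γ → Word
code g = map τ (toList (h g))

-- The parity of x p is that of p (x-parity), so it is known from the position alone.
Decodable : ℕ → ℕ → Set
Decodable c ℓ = ∀ g g′ → toℕ g % 2 ≡ toℕ g′ % 2 →
                take ℓ (drop c (code g)) ≡ take ℓ (drop c (code g′)) → τ g ≡ τ g′

decodable? : ∀ c ℓ → Dec (Decodable c ℓ)
decodable? c ℓ = all? λ g → all? λ g′ → toℕ g % 2 ≟ toℕ g′ % 2
  →-dec ≡-dec Fin._≟_ (take ℓ (drop c (code g))) (take ℓ (drop c (code g′))) →-dec τ g Fin.≟ τ g′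

factor-w₀-block : ∀ p (c : Fin 4) {ℓ} → toℕ c + ℓ ≤ 4 →
                  factor w₀ (toℕ c + p * 4) ℓ ≡ take ℓ (drop (toℕ c) (code (x p)))
factor-w₀-block p c {ℓ} fits = begin
  factor w₀ (toℕ c + p * 4) ℓ                              ≡⟨ map-factor τ x (toℕ c + p * 4) ℓ ⟨
  map τ (factor x (toℕ c + p * 4) ℓ)                       ≡⟨ cong (map τ) (factor-fix-in-image p 1 c fits) ⟩
  map τ (take ℓ (drop (toℕ c) (toList (h (x p)) ++ [])))   ≡⟨ cong (map τ ∘ take ℓ ∘ drop (toℕ c)) (++-identityʳ _) ⟩
  map τ (take ℓ (drop (toℕ c) (toList (h (x p)))))         ≡⟨ take-map ℓ _ ⟨
  take ℓ (map τ (drop (toℕ c) (toList (h (x p)))))         ≡⟨ cong (take ℓ) (drop-map (toℕ c) _) ⟨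
  take ℓ (drop (toℕ c) (code (x p)))                       ∎

decode : ∀ (c : Fin 4) {ℓ} → Decodable (toℕ c) ℓ → toℕ c + ℓ ≤ 4 → ∀ p p′ → p % 2 ≡ p′ % 2 →
         factor w₀ (toℕ c + p * 4) ℓ ≡ factor w₀ (toℕ c + p′ * 4) ℓ → w₀ p ≡ w₀ p′
decode c decodable fits p p′ parities eq =
  decodable (x p) (x p′) (trans (x-parity p) (trans parities (sym (x-parity p′))))
            (trans (sym (factor-w₀-block p c fits)) (trans eq (factor-w₀-block p′ c fits)))

square-desubstitute : ∀ (c : Fin 4) {ℓ} d {i n j m} → Decodable (toℕ c) ℓ → toℕ c + ℓ ≤ 4 → d + ℓ ≤ 4 →
                      i + d ≡ toℕ c + j * 4 → n ≡ m * 4 → 2 ∣ m → Square w₀ i n → Square w₀ j m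
square-desubstitute c {ℓ} d {i} {n} {j} {m} decodable c+ℓ≤4 d+ℓ≤4 start n≡m*4 2∣m sq t t<m =
  decode c decodable c+ℓ≤4 (j + t) (j + m + t) parities
    (subst₂ (λ p p′ → factor w₀ p ℓ ≡ factor w₀ p′ ℓ) (sym here) (sym there)
            (square⇒factor≡ w₀ i n {e} {ℓ} fits sq))
  where
  e : ℕ
  e = d + t * 4
  parities : (j + t) % 2 ≡ (j + m + t) % 2
  parities = trans (sym (%-remove-+ʳ (j + t) 2∣m)) (cong (_% 2) (shape j t m))
    where
    shape : ∀ j t m → j + t + m ≡ j + m + t
    shape = solve-∀
  here : toℕ c + (j + t) * 4 ≡ i + e
  here = begin
    toℕ c + (j + t) * 4     ≡⟨ shape (toℕ c) j t ⟩
    toℕ c + j * 4 + t * 4   ≡⟨ cong (_+ t * 4) start ⟨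
    i + d + t * 4           ≡⟨ +-assoc i d (t * 4) ⟩
    i + e                   ∎
    where
    shape : ∀ c j t → c + (j + t) * 4 ≡ c + j * 4 + t * 4
    shape = solve-∀
  there : toℕ c + (j + m + t) * 4 ≡ i + n + e
  there = begin
    toℕ c + (j + m + t) * 4         ≡⟨ shape (toℕ c) j m t ⟩
    toℕ c + j * 4 + t * 4 + m * 4   ≡⟨ cong₂ (λ p q → p + t * 4 + q) start n≡m*4 ⟨
    i + d + t * 4 + n               ≡⟨ shape′ i d t n ⟩
    i + n + e                       ∎
    where
    shape : ∀ c j m t → c + (j + m + t) * 4 ≡ c + j * 4 + t * 4 + m * 4
    shape = solve-∀
    shape′ : ∀ i d t n → i + d + t * 4 + n ≡ i + n + (d + t * 4)
    shape′ = solve-∀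
  fits : e + ℓ ≤ n
  fits = ≤-trans (≤-reflexive (shape d t ℓ))
           (≤-trans (+-monoˡ-≤ (t * 4) d+ℓ≤4) (≤-trans (*-monoˡ-≤ 4 t<m) (≤-reflexive (sym n≡m*4))))
    where
    shape : ∀ d t ℓ → d + t * 4 + ℓ ≡ d + ℓ + t * 4
    shape = solve-∀

-- In a square of period 4m at r + 4q, the first period shows the blocks q, …, q + m − 1 from
-- offset r on when r ≤ 2, and the first three letters of the blocks q + 1, …, q + m when r = 3.
square-desubstitute-at : ∀ (r : Fin 4) q {i n m} → i ≡ toℕ r + q * 4 → n ≡ m * 4 → 2 ∣ m →
                         Square w₀ i n → ∃ λ j → Square w₀ j m
square-desubstitute-at 0F q {i} {n} {m} start n≡m*4 2∣m sq =
  q , square-desubstitute 0F 0 {i} {n} {q} {m} (from-yes (decodable? 0 4)) ≤-refl ≤-refl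
        (trans (+-identityʳ i) start) n≡m*4 2∣m sq
square-desubstitute-at 1F q {i} {n} {m} start n≡m*4 2∣m sq =
  q , square-desubstitute 1F 0 {i} {n} {q} {m} (from-yes (decodable? 1 3)) ≤-refl (n≤1+n 3)
        (trans (+-identityʳ i) start) n≡m*4 2∣m sq
square-desubstitute-at 2F q {i} {n} {m} start n≡m*4 2∣m sq =
  q , square-desubstitute 2F 0 {i} {n} {q} {m} (from-yes (decodable? 2 2)) ≤-refl (m≤m+n 2 2)
        (trans (+-identityʳ i) start) n≡m*4 2∣m sq
square-desubstitute-at 3F q {i} {n} {m} start n≡m*4 2∣m sq =
  suc q , square-desubstitute 0F 1 {i} {n} {suc q} {m} (from-yes (decodable? 0 3)) (n≤1+n 3) ≤-refl
            (trans (cong (_+ 1) start) (+-comm (3 + q * 4) 1)) n≡m*4 2∣m sq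

long-square-descends : ∀ i n → 12 ≤ n → Square w₀ i n → ∃₂ λ j m → 1 ≤ m × m < n × Square w₀ j m
long-square-descends i n 12≤n sq = proj₁ desubstituted , m , 1≤m , m<n , proj₂ desubstituted
  where
  q q′ : ℕ
  q  = i / 4
  q′ = (i + n) / 4
  r r′ : Fin 4
  r  = i mod 4
  r′ = (i + n) mod 4
  i≡ : i ≡ toℕ r + q * 4
  i≡ = DivMod.property (i divMod 4)
  i+n≡ : i + n ≡ toℕ r′ + q′ * 4
  i+n≡ = DivMod.property ((i + n) divMod 4)
  synced : r ≡ r′ × q % 2 ≡ q′ % 2
  synced = synchronizing q q′ r r′ (subst₂ (λ p p′ → factor w₀ p 12 ≡ factor w₀ p′ 12) i≡ i+n≡
                                           (square⇒prefix≡ w₀ i n 12≤n sq))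
  aligned : q ≤ q′ × n ≡ (q′ ∸ q) * 4
  aligned = aligned-period 4 (begin
    toℕ r + q * 4 + n   ≡⟨ cong (_+ n) i≡ ⟨
    i + n               ≡⟨ i+n≡ ⟩
    toℕ r′ + q′ * 4     ≡⟨ cong (λ r → toℕ r + q′ * 4) (proj₁ synced) ⟨
    toℕ r + q′ * 4      ∎)
  m : ℕ
  m = q′ ∸ q
  n≡m*4 : n ≡ m * 4
  n≡m*4 = proj₂ aligned
  2∣m : 2 ∣ m
  2∣m = ≡-mod⇒∣-difference 2 q m (trans (cong (_% 2) (m+[n∸m]≡n (proj₁ aligned))) (sym (proj₂ synced)))
  1≤m : 1 ≤ m
  1≤m = *-cancelʳ-≤ 1 m 4 (≤-trans (m≤m+n 4 8) (≤-trans 12≤n (≤-reflexive n≡m*4)))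
  m<n : m < n
  m<n = <-≤-trans (m<m*n m 4 {{>-nonZero 1≤m}} (s≤s (s≤s z≤n))) (≤-reflexive (sym n≡m*4))
  desubstituted : ∃ λ j → Square w₀ j m
  desubstituted = square-desubstitute-at r q i≡ n≡m*4 2∣m sq

w₀-dean : Dean w₀
w₀-dean = w₀-reduced , squareFree-by-descent w₀ 12 no-short-squares long-square-descends

-- Rotations of w₀ and their sets D₃

rotate : Fin 4 → Letter → Letter
rotate k a = (toℕ a + toℕ k) mod 4

rotate-injective : ∀ k {a b} → rotate k a ≡ rotate k b → a ≡ b
rotate-injective k {a} {b} = checked k a b
  where
  checked : ∀ k a b → rotate k a ≡ rotate k b → a ≡ b
  checked = from-yes (all? λ (k : Fin 4) → all? λ (a : Letter) → all? λ (b : Letter) →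
    rotate k a Fin.≟ rotate k b →-dec a Fin.≟ b)

rotate-reflects-forbidden : ∀ k {a b} → Forbidden (rotate k a) (rotate k b) → Forbidden a b
rotate-reflects-forbidden k {a} {b} = checked k a b
  where
  checked : ∀ k a b → Forbidden (rotate k a) (rotate k b) → Forbidden a b
  checked = from-yes (all? λ (k : Fin 4) → all? λ (a : Letter) → all? λ (b : Letter) →
    forbidden? (rotate k a) (rotate k b) →-dec forbidden? a b)

deanWord : Fin 4 → InfWord
deanWord k = rotate k ∘ w₀

deanWord-dean : ∀ k → Dean (deanWord k)
deanWord-dean k = Dean-map {w₀} (rotate k) (rotate-injective k) (rotate-reflects-forbidden k) w₀-dean

factor⇔early-occurrence : ∀ (f : Γ → Letter) v → length v ≤ 4 →
                          Factor v (f ∘ x) ⇔ ∃ λ (j : Fin 28) → factor (f ∘ x) (toℕ j) (length v) ≡ v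
factor⇔early-occurrence f v |v|≤4 = mk⇔ to from
  where
  to : Factor v (f ∘ x) → ∃ λ (j : Fin 28) → factor (f ∘ x) (toℕ j) (length v) ≡ v
  to (i , occurs) = j , trans (sym moved) (Equivalence.to (occursAt⇔factor v (f ∘ x) i) occurs)
    where
    j : Fin 28
    j = proj₁ (represented₄ i)
    moved : factor (f ∘ x) i (length v) ≡ factor (f ∘ x) (toℕ j) (length v)
    moved = factor-≡-take (f ∘ x) i (toℕ j) |v|≤4 (factor-∘-cong f x i (toℕ j) 4 (proj₂ (represented₄ i)))
  from : (∃ λ (j : Fin 28) → factor (f ∘ x) (toℕ j) (length v) ≡ v) → Factor v (f ∘ x)
  from (j , eq) = toℕ j , Equivalence.from (occursAt⇔factor v (f ∘ x) (toℕ j)) eq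

factor? : ∀ (f : Γ → Letter) v → length v ≤ 4 → Dec (Factor v (f ∘ x))
factor? f v |v|≤4 = Dec.map′ (Equivalence.from early) (Equivalence.to early)
  (any? λ (j : Fin 28) → ≡-dec Fin._≟_ (factor (f ∘ x) (toℕ j) (length v)) v)
  where
  early : Factor v (f ∘ x) ⇔ ∃ λ (j : Fin 28) → factor (f ∘ x) (toℕ j) (length v) ≡ v
  early = factor⇔early-occurrence f v |v|≤4

inD₃? : ∀ k a b c → Dec (InD 3 (deanWord k) (a ∷ b ∷ c ∷ []))
inD₃? k a b c = yes refl ×-dec reducedW? (a ∷ b ∷ c ∷ []) ×-dec ¬? (factor? f (a ∷ b ∷ c ∷ []) (n≤1+n 3))
                ×-dec factor? f (a ∷ b ∷ []) (m≤m+n 2 2) ×-dec factor? f (b ∷ c ∷ []) (m≤m+n 2 2)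
  where
  f : Γ → Letter
  f = rotate k ∘ τ

D₃? : ∀ k T → Dec (∀ a b c → InD 3 (deanWord k) (a ∷ b ∷ c ∷ []) ⇔ (a ∷ b ∷ c ∷ []) ∈ T)
D₃? k T = all? λ a → all? λ b → all? λ c → inD₃? k a b c ⇔? ((a ∷ b ∷ c ∷ []) ∈? T)

deanWord-D₃ : ∀ k T {lengths : True (All.all? (λ v → length v ≟ 3) T)} {triples : True (D₃? k T)} →
              DEquals 3 (deanWord k) T
deanWord-D₃ k T {lengths} {triples} = DEquals₃ (toWitness lengths) (toWitness triples)

mainTheorem2 : (i : Fin 4) → ∃ λ (w : InfWord) → Dean w × DEquals 3 w (S i)
mainTheorem2 0F = deanWord 0F , deanWord-dean 0F , deanWord-D₃ 0F S₁
mainTheorem2 1F = deanWord 3F , deanWord-dean 3F , deanWord-D₃ 3F S₂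
mainTheorem2 2F = deanWord 1F , deanWord-dean 1F , deanWord-D₃ 1F S₃
mainTheorem2 3F = deanWord 2F , deanWord-dean 2F , deanWord-D₃ 2F S₄
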